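{- Let $d$ be a dyadic rational with $0\le d<1$, with binary expansion $d=\sum_{i\ge1}d_i2^{ -i}$ ($d_i\in\{0,1\}$, finitely many nonzero), and let $m$ be an integer. (1) If $m\ge 0$, then $\{d\mid\,\}:m=m+1$. (2) If $m<0$, then $\{d\mid\,\}:m=\sum_{i=1}^{j-1}d_i2^{ -i}+2^{ -j}$ (binary $0.d_1d_2\ldots d_{j-1}1$), where $j$ is the index of the $|m|$-th zero digit of the binary expansion of $d$.
   Context: Short partizan games under normal play. For game forms $G,H$ the ordinal sum is $G:H=\{G^{\mathcal L},G:H^{\mathcal L}\,|\,G^{\mathcal R},G:H^{\mathcal R}\}$, using the options of the literal form of the base $G$ and of the subordinate $H$. $\{x\mid\,\}$ denotes the game with single Left option $x$ and no Right option (used literally as the base). Binary expansions are infinite digit sequences with $0$-digits after the last $1$-digit, so the $|m|$-th zero digit may lie beyond the last nonzero digit. Equalities are equalities of game values. -}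

module Defs where

open import Data.Nat as ℕ using (ℕ; zero; suc; _+_; _*_; _∸_; _^_; _≤ᵇ_)
open import Data.Nat.DivMod using (_/_; _%_)
open import Data.Integer as ℤ using (ℤ; +_; -[1+_])
open import Data.Integer.Base using (_%ℕ_; _/ℕ_)
open import Data.Bool using (Bool; true; false; if_then_else_)
open import Data.List using (List; []; _∷_; _++_; [_])
open import Data.Unit using (⊤)
open import Data.Empty using (⊥)
open import Data.Product using (_×_)
open import Relation.Nullary using (¬_)

data Game : Set where
  mk : List Game → List Game → Game

leftOpts : Game → List Game
leftOpts (mk L _) = L

rightOpts : Game → List Game
rightOpts (mk _ R) = R

mutual
  _≤G_ : Game → Game → Set
  mk GL GR ≤G mk HL HR = noLeftAbove GL (mk HL HR) × noRightBelow HR (mk GL GR)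

  noLeftAbove : List Game → Game → Set
  noLeftAbove []         H = ⊤
  noLeftAbove (gl ∷ gls) H = ¬ (H ≤G gl) × noLeftAbove gls H

  noRightBelow : List Game → Game → Set
  noRightBelow []         G = ⊤
  noRightBelow (hr ∷ hrs) G = ¬ (hr ≤G G) × noRightBelow hrs G

_≈G_ : Game → Game → Set
G ≈G H = (G ≤G H) × (H ≤G G)

infix 4 _≤G_ _≈G_

-- Ordinal sum  G : H = { G^L , G : H^L | G^R , G : H^R }
-- (options of the literal form of the base G and of the subordinate H).

mutual
  ordSum : Game → Game → Game
  ordSum G (mk HL HR) = mk (leftOpts G ++ ordSums G HL) (rightOpts G ++ ordSums G HR)

  ordSums : Game → List Game → List Game
  ordSums G []       = []
  ordSums G (h ∷ hs) = ordSum G h ∷ ordSums G hs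

natGame : ℕ → Game
natGame zero    = mk [] []
natGame (suc n) = mk [ natGame n ] []

negGame : ℕ → Game   -- negGame n is the game -(n+1)
negGame zero    = mk [] [ natGame zero ]
negGame (suc n) = mk [] [ negGame n ]

intGame : ℤ → Game
intGame (+ n)    = natGame n
intGame -[1+ n ] = negGame n

-- Dyadic rationals a / 2^k as games (canonical forms):
-- k = 0: the integer a; a even: a/2 over 2^(k-1);
-- a odd: { (a-1)/2^k | (a+1)/2^k }.

dyadic : ℤ → ℕ → Game
dyadic a zero = intGame a
dyadic a (suc k) with a %ℕ 2
... | zero  = dyadic (a /ℕ 2) k
... | suc _ = mk [ dyadic (a /ℕ 2) k ] [ dyadic (a /ℕ 2 ℤ.+ ℤ.+ 1) k ]

-- Binary expansion of d = a / 2^k (0 ≤ a < 2^k):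
-- digit a k i = d_i  (i ≥ 1), as 0/1; digits beyond position k are 0.

shiftR : ℕ → ℕ → ℕ
shiftR a zero    = a
shiftR a (suc n) = shiftR (a / 2) n

digit : ℕ → ℕ → ℕ → ℕ
digit a k zero    = 0    -- unused (digits are indexed from 1)
digit a k (suc i) = if suc i ≤ᵇ k then shiftR a (k ∸ suc i) % 2 else 0

isZeroDigit : ℕ → ℕ
isZeroDigit zero    = 1
isZeroDigit (suc _) = 0

zerosUpTo : ℕ → ℕ → ℕ → ℕ
zerosUpTo a k zero    = 0
zerosUpTo a k (suc j) = zerosUpTo a k j + isZeroDigit (digit a k (suc j))

prefixSum : ℕ → ℕ → ℕ → ℕ → ℕ
prefixSum a k j zero    = 0
prefixSum a k j (suc n) = prefixSum a k j n + digit a k (suc n) * 2 ^ (j ∸ suc n)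

-- numerator over 2^j of  Σ_{i=1}^{j-1} d_i 2^{-i} + 2^{-j}
-- i.e. of the binary number 0.d_1 … d_{j-1} 1
truncNum : ℕ → ℕ → ℕ → ℕ
truncNum a k j = prefixSum a k j (j ∸ 1) + 1

baseGame : ℕ → ℕ → Game
baseGame a k = mk [ dyadic (+ a) k ] []

-- Canonical dyadic game forms compare exactly as their values: for ≤ one only needs that left
-- options lie below and right options above, for the strict part the simplicity of an odd
-- fraction (2c+1)/2^(k+1), which is separated from any other number by one of its options.
-- Write G = {d |}.  For n ≥ 0 the left options of G : n are d < 1 and G : (n-1) = n, so
-- G : n = n + 1.  For n < 0, G : -(z+1) = {d | G : -z}.  Let L_i = ⌊2^i d⌋ (the first i digits)
-- and z_i the number of zeros among them; then G : -z_i = (L_i + 1)/2^i.  A digit 1 changes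
-- neither side, and a digit 0 turns the game into {d | (L_i+1)/2^i}, which equals
-- {L_i/2^i | (L_i+1)/2^i} = (2L_i+1)/2^(i+1) because L_i/2^i ≤ d < (2L_i+1)/2^(i+1).

module Submission where

open import Defs
open import Data.Nat
open import Data.Nat.Properties
open import Data.Nat.DivMod using (_/_; _%_; m/n*n≤m; m%n<n; m≡m%n+[m/n]*n; m/n/o≡m/[n*o]; n/1≡n;
  m*n/n≡m; m*n%n≡0; [m+kn]%n≡m%n; +-distrib-/; m<n⇒m/n≡0)
open import Data.Nat.Tactic.RingSolver using (solve-∀)
open import Data.Integer as ℤ using (ℤ; +_; -[1+_]; ∣_∣)
open import Data.Bool using (true; false)
open import Data.List using ([]; _∷_; [_])
open import Data.Product using (_×_; _,_; proj₁; proj₂)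
open import Data.Sum using (_⊎_; inj₁; inj₂; [_,_]′)
open import Data.Unit using (tt)
open import Relation.Nullary using (¬_)
open import Relation.Nullary.Decidable using (dec-true; dec-false)
open import Relation.Binary.PropositionalEquality hiding ([_])

2^n≢0 : ∀ n → NonZero (2 ^ n)
2^n≢0 n = m^n≢0 2 n

record Dyadic : Set where
  constructor _/2^_
  field
    numerator exponent : ℕ

infix 5 _/2^_
infix 4 _≤ᵈ_ _<ᵈ_

_≤ᵈ_ _<ᵈ_ : Dyadic → Dyadic → Set
(a /2^ k) ≤ᵈ (b /2^ l) = a * 2 ^ l ≤ b * 2 ^ k
(a /2^ k) <ᵈ (b /2^ l) = a * 2 ^ l < b * 2 ^ k

private
  x*y*z≡x*z*y : ∀ x y z → x * y * z ≡ x * z * y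
  x*y*z≡x*z*y = solve-∀

  x*2*y≡2*[x*y] : ∀ x y → x * 2 * y ≡ 2 * (x * y)
  x*2*y≡2*[x*y] = solve-∀

  x*[2*y]≡2*[x*y] : ∀ x y → x * (2 * y) ≡ 2 * (x * y)
  x*[2*y]≡2*[x*y] = solve-∀

  x*[y*z]≡x*z*y : ∀ x y z → x * (y * z) ≡ x * z * y
  x*[y*z]≡x*z*y = solve-∀

2^-split : ∀ {m n} → m ≤ n → 2 ^ n ≡ 2 ^ m * 2 ^ (n ∸ m)
2^-split {m} {n} m≤n = trans (cong (2 ^_) (sym (m+[n∸m]≡n m≤n))) (^-distribˡ-+-* 2 m (n ∸ m))

≤ᵈ-<ᵈ-trans : ∀ x y z → x ≤ᵈ y → y <ᵈ z → x <ᵈ z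
≤ᵈ-<ᵈ-trans (a /2^ k) (b /2^ l) (c /2^ m) x≤y y<z =
  *-cancelʳ-< (2 ^ l) (a * 2 ^ m) (c * 2 ^ k) (begin-strict
    a * 2 ^ m * 2 ^ l  ≡⟨ x*y*z≡x*z*y a _ _ ⟩
    a * 2 ^ l * 2 ^ m  ≤⟨ *-monoˡ-≤ (2 ^ m) x≤y ⟩
    b * 2 ^ k * 2 ^ m  ≡⟨ x*y*z≡x*z*y b _ _ ⟩
    b * 2 ^ m * 2 ^ k  <⟨ *-monoˡ-< (2 ^ k) {{2^n≢0 k}} y<z ⟩
    c * 2 ^ l * 2 ^ k  ≡⟨ x*y*z≡x*z*y c _ _ ⟩
    c * 2 ^ k * 2 ^ l  ∎)
  where open ≤-Reasoning

<ᵈ-≤ᵈ-trans : ∀ x y z → x <ᵈ y → y ≤ᵈ z → x <ᵈ z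
<ᵈ-≤ᵈ-trans (a /2^ k) (b /2^ l) (c /2^ m) x<y y≤z =
  *-cancelʳ-< (2 ^ l) (a * 2 ^ m) (c * 2 ^ k) (begin-strict
    a * 2 ^ m * 2 ^ l  ≡⟨ x*y*z≡x*z*y a _ _ ⟩
    a * 2 ^ l * 2 ^ m  <⟨ *-monoˡ-< (2 ^ m) {{2^n≢0 m}} x<y ⟩
    b * 2 ^ k * 2 ^ m  ≡⟨ x*y*z≡x*z*y b _ _ ⟩
    b * 2 ^ m * 2 ^ k  ≤⟨ *-monoˡ-≤ (2 ^ k) y≤z ⟩
    c * 2 ^ l * 2 ^ k  ≡⟨ x*y*z≡x*z*y c _ _ ⟩
    c * 2 ^ k * 2 ^ l  ∎)
  where open ≤-Reasoning

≤ᵈ-halveˡ : ∀ a k y → (a * 2 /2^ suc k) ≤ᵈ y → (a /2^ k) ≤ᵈ y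
≤ᵈ-halveˡ a k (b /2^ l) h = *-cancelˡ-≤ 2 (subst₂ _≤_ (x*2*y≡2*[x*y] a _) (x*[2*y]≡2*[x*y] b _) h)

≤ᵈ-halveʳ : ∀ x b l → x ≤ᵈ (b * 2 /2^ suc l) → x ≤ᵈ (b /2^ l)
≤ᵈ-halveʳ (a /2^ k) b l h = *-cancelˡ-≤ 2 (subst₂ _≤_ (x*[2*y]≡2*[x*y] a _) (x*2*y≡2*[x*y] b _) h)

<ᵈ-halveˡ : ∀ a k y → (a * 2 /2^ suc k) <ᵈ y → (a /2^ k) <ᵈ y
<ᵈ-halveˡ a k (b /2^ l) h = *-cancelˡ-< 2 _ _ (subst₂ _<_ (x*2*y≡2*[x*y] a _) (x*[2*y]≡2*[x*y] b _) h)

<ᵈ-halveʳ : ∀ x b l → x <ᵈ (b * 2 /2^ suc l) → x <ᵈ (b /2^ l)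
<ᵈ-halveʳ (a /2^ k) b l h = *-cancelˡ-< 2 _ _ (subst₂ _<_ (x*[2*y]≡2*[x*y] a _) (x*2*y≡2*[x*y] b _) h)

n<ᵈ1+n : ∀ n → (n /2^ 0) <ᵈ (suc n /2^ 0)
n<ᵈ1+n n = *-monoˡ-< 1 (n<1+n n)

half<ᵈodd : ∀ c k → (c /2^ k) <ᵈ (suc (c * 2) /2^ suc k)
half<ᵈodd c k = subst (_< suc (c * 2) * 2 ^ k) (*-assoc c 2 (2 ^ k))
  (*-monoˡ-< (2 ^ k) {{2^n≢0 k}} (n<1+n (c * 2)))

odd<ᵈhalf : ∀ c k → (suc (c * 2) /2^ suc k) <ᵈ (suc c /2^ k)
odd<ᵈhalf c k = subst (suc (c * 2) * 2 ^ k <_) (*-assoc (suc c) 2 (2 ^ k))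
  (*-monoˡ-< (2 ^ k) {{2^n≢0 k}} (n<1+n (suc (c * 2))))

-- The simplicity of (2e+1)/2^(l+1): a number below it whose denominator is no larger already
-- lies below its left option e/2^l, since clearing denominators leaves an integer inequality
-- a·2^t < 2e+1 that sharpens to a·2^t ≤ 2e.
<ᵈ-odd⇒≤ᵈ-leftOption : ∀ a K e l → K ≤ suc l →
  (a /2^ K) <ᵈ (suc (e * 2) /2^ suc l) → (a /2^ K) ≤ᵈ (e /2^ l)
<ᵈ-odd⇒≤ᵈ-leftOption a K e l K≤1+l x<y = *-cancelˡ-≤ 2 (begin
    2 * (a * 2 ^ l)  ≡⟨ x*[2*y]≡2*[x*y] a _ ⟨
    a * 2 ^ suc l    ≡⟨ clear ⟩
    a * T * 2 ^ K    ≤⟨ *-monoˡ-≤ (2 ^ K) aT≤2e ⟩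
    e * 2 * 2 ^ K    ≡⟨ x*2*y≡2*[x*y] e _ ⟩
    2 * (e * 2 ^ K)  ∎)
  where
  open ≤-Reasoning
  T = 2 ^ (suc l ∸ K)
  clear : a * 2 ^ suc l ≡ a * T * 2 ^ K
  clear = trans (cong (a *_) (2^-split K≤1+l)) (x*[y*z]≡x*z*y a _ _)
  aT≤2e : a * T ≤ e * 2
  aT≤2e = m<1+n⇒m≤n (*-cancelʳ-< (2 ^ K) (a * T) (suc (e * 2)) (subst (_< suc (e * 2) * 2 ^ K) clear x<y))

<ᵈ-odd⇒≤ᵈ-rightOption : ∀ c k b l → l ≤ suc k →
  (suc (c * 2) /2^ suc k) <ᵈ (b /2^ l) → (suc c /2^ k) ≤ᵈ (b /2^ l)
<ᵈ-odd⇒≤ᵈ-rightOption c k b l l≤1+k x<y = *-cancelˡ-≤ 2 (begin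
    2 * (suc c * 2 ^ l)  ≡⟨ x*2*y≡2*[x*y] (suc c) (2 ^ l) ⟨
    suc c * 2 * 2 ^ l    ≤⟨ *-monoˡ-≤ (2 ^ l) 2c+2≤bT ⟩
    b * T * 2 ^ l        ≡⟨ clear ⟨
    b * 2 ^ suc k        ≡⟨ x*[2*y]≡2*[x*y] b _ ⟩
    2 * (b * 2 ^ k)      ∎)
  where
  open ≤-Reasoning
  T = 2 ^ (suc k ∸ l)
  clear : b * 2 ^ suc k ≡ b * T * 2 ^ l
  clear = trans (cong (b *_) (2^-split l≤1+k)) (x*[y*z]≡x*z*y b _ _)
  2c+2≤bT : suc c * 2 ≤ b * T
  2c+2≤bT = *-cancelʳ-< (2 ^ l) (suc (c * 2)) (b * T) (subst (suc (c * 2) * 2 ^ l <_) clear x<y)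

≤G-intro : ∀ {G H} → noLeftAbove (leftOpts G) H → noRightBelow (rightOpts H) G → G ≤G H
≤G-intro {mk _ _} {mk _ _} = _,_

≤-leftOption⇒≱G : ∀ {G l L R} → G ≤G l → ¬ (mk (l ∷ L) R ≤G G)
≤-leftOption⇒≱G {mk _ _} G≤l H≤G = proj₁ (proj₁ H≤G) G≤l

rightOption-≤⇒≱G : ∀ {H r L R} → r ≤G H → ¬ (H ≤G mk L (r ∷ R))
rightOption-≤⇒≱G {mk _ _} r≤H H≤G = proj₁ (proj₂ H≤G) r≤H

data DyadicForm : Game → Dyadic → Set where
  zero-form : DyadicForm (natGame 0) (0 /2^ 0)
  suc-form  : ∀ {n} → DyadicForm (natGame n) (n /2^ 0) → DyadicForm (natGame (suc n)) (suc n /2^ 0)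
  rescaled  : ∀ {G a k} → DyadicForm G (a /2^ k) → DyadicForm G (a * 2 /2^ suc k)
  odd-form  : ∀ {L R c k} → DyadicForm L (c /2^ k) → DyadicForm R (suc c /2^ k) →
              DyadicForm (mk [ L ] [ R ]) (suc (c * 2) /2^ suc k)

mutual
  ≤ᵈ⇒≤G : ∀ {G H x y} → DyadicForm G x → DyadicForm H y → x ≤ᵈ y → G ≤G H
  ≤ᵈ⇒≤G g h x≤y = ≤G-intro (leftOptions-≱G g h x≤y) (rightOptions-≱G g h x≤y)

  leftOptions-≱G : ∀ {G H x y} → DyadicForm G x → DyadicForm H y → x ≤ᵈ y →
                   noLeftAbove (leftOpts G) H
  leftOptions-≱G zero-form h x≤y = tt
  leftOptions-≱G {y = y} (suc-form {n} g) h x≤y =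
    <ᵈ⇒≱G g h (<ᵈ-≤ᵈ-trans (n /2^ 0) (suc n /2^ 0) y (n<ᵈ1+n n) x≤y) , tt
  leftOptions-≱G {y = y} (rescaled {a = a} {k} g) h x≤y = leftOptions-≱G g h (≤ᵈ-halveˡ a k y x≤y)
  leftOptions-≱G {y = y} (odd-form {c = c} {k} gl gr) h x≤y =
    <ᵈ⇒≱G gl h (<ᵈ-≤ᵈ-trans (c /2^ k) (suc (c * 2) /2^ suc k) y (half<ᵈodd c k) x≤y) , tt

  rightOptions-≱G : ∀ {G H x y} → DyadicForm G x → DyadicForm H y → x ≤ᵈ y →
                    noRightBelow (rightOpts H) G
  rightOptions-≱G g zero-form x≤y = tt
  rightOptions-≱G g (suc-form h) x≤y = tt
  rightOptions-≱G {x = x} g (rescaled {a = b} {l} h) x≤y = rightOptions-≱G g h (≤ᵈ-halveʳ x b l x≤y)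
  rightOptions-≱G {x = x} g (odd-form {c = c} {l} hl hr) x≤y =
    <ᵈ⇒≱G g hr (≤ᵈ-<ᵈ-trans x (suc (c * 2) /2^ suc l) (suc c /2^ l) x≤y (odd<ᵈhalf c l)) , tt

  <ᵈ⇒≱G : ∀ {G H x y} → DyadicForm G x → DyadicForm H y → x <ᵈ y → ¬ (H ≤G G)
  <ᵈ⇒≱G {y = y} (rescaled {a = a} {k} g) h x<y = <ᵈ⇒≱G g h (<ᵈ-halveˡ a k y x<y)
  <ᵈ⇒≱G {x = x} g (rescaled {a = b} {l} h) x<y = <ᵈ⇒≱G g h (<ᵈ-halveʳ x b l x<y)
  <ᵈ⇒≱G g zero-form ()
  <ᵈ⇒≱G zero-form (suc-form h) x<y ((G≰n , _) , _) = G≰n (≤ᵈ⇒≤G zero-form h (m<1+n⇒m≤n x<y))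
  <ᵈ⇒≱G (suc-form g) (suc-form h) x<y ((G≰n , _) , _) = G≰n (≤ᵈ⇒≤G (suc-form g) h (m<1+n⇒m≤n x<y))
  <ᵈ⇒≱G (odd-form {c = c} {k} gl gr) (suc-form {n} h) x<y (_ , (gr≰H , _)) =
    gr≰H (≤ᵈ⇒≤G gr (suc-form h) (<ᵈ-odd⇒≤ᵈ-rightOption c k (suc n) 0 z≤n x<y))
  <ᵈ⇒≱G zero-form (odd-form {c = e} {l} hl hr) x<y ((G≰hl , _) , _) =
    G≰hl (≤ᵈ⇒≤G zero-form hl (<ᵈ-odd⇒≤ᵈ-leftOption 0 0 e l z≤n x<y))
  <ᵈ⇒≱G (suc-form {n} g) (odd-form {c = e} {l} hl hr) x<y ((G≰hl , _) , _) =
    G≰hl (≤ᵈ⇒≤G (suc-form g) hl (<ᵈ-odd⇒≤ᵈ-leftOption (suc n) 0 e l z≤n x<y))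
  <ᵈ⇒≱G g@(odd-form {c = c} {k} gl gr) h@(odd-form {c = e} {l} hl hr) x<y ((G≰hl , _) , (gr≰H , _)) =
    [ (λ k≤l → G≰hl (≤ᵈ⇒≤G g hl
        (<ᵈ-odd⇒≤ᵈ-leftOption (suc (c * 2)) (suc k) e l (s≤s k≤l) x<y)))
    , (λ l≤k → gr≰H (≤ᵈ⇒≤G gr h
        (<ᵈ-odd⇒≤ᵈ-rightOption c k (suc (e * 2)) (suc l) (s≤s l≤k) x<y)))
    ]′ (≤-total k l)

data EvenOdd : ℕ → Set where
  even : ∀ c → EvenOdd (c * 2)
  odd  : ∀ c → EvenOdd (suc (c * 2))

evenOdd : ∀ a → EvenOdd a
evenOdd zero = even 0
evenOdd (suc zero) = odd 0
evenOdd (suc (suc a)) with evenOdd a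
... | even c = even (suc c)
... | odd c = odd (suc c)

dyadic-even : ∀ c k → dyadic (+ (c * 2)) (suc k) ≡ dyadic (+ c) k
dyadic-even c k rewrite m*n%n≡0 c 2 {{_}} | m*n/n≡m c 2 {{_}} = refl

[1+c*2]/2≡c : ∀ c → suc (c * 2) / 2 ≡ c
[1+c*2]/2≡c c =
  trans (+-distrib-/ 1 (c * 2) (subst (λ r → 1 + r < 2) (sym (m*n%n≡0 c 2)) ≤-refl)) (m*n/n≡m c 2)

dyadic-odd : ∀ c k → dyadic (+ suc (c * 2)) (suc k) ≡ mk [ dyadic (+ c) k ] [ dyadic (+ suc c) k ]
dyadic-odd c k rewrite [m+kn]%n≡m%n 1 c 2 {{_}} | [1+c*2]/2≡c c | +-comm c 1 = refl

natGame-form : ∀ n → DyadicForm (natGame n) (n /2^ 0)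
natGame-form zero = zero-form
natGame-form (suc n) = suc-form (natGame-form n)

dyadic-form : ∀ a k → DyadicForm (dyadic (+ a) k) (a /2^ k)
dyadic-form a zero = natGame-form a
dyadic-form a (suc k) with evenOdd a
... | even c = subst (λ G → DyadicForm G (c * 2 /2^ suc k)) (sym (dyadic-even c k)) (rescaled (dyadic-form c k))
... | odd c = subst (λ G → DyadicForm G (suc (c * 2) /2^ suc k)) (sym (dyadic-odd c k))
                (odd-form (dyadic-form c k) (dyadic-form (suc c) k))

m<[1+m/n]*n : ∀ m n .{{_ : NonZero n}} → m < suc (m / n) * n
m<[1+m/n]*n m n = subst (_< n + m / n * n) (sym (m≡m%n+[m/n]*n m n)) (+-monoˡ-< (m / n * n) (m%n<n m n))

shiftR-suc : ∀ a n → shiftR a (suc n) ≡ shiftR a n / 2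
shiftR-suc a zero = refl
shiftR-suc a (suc n) = shiftR-suc (a / 2) n

shiftR≡/2^ : ∀ a n → shiftR a n ≡ _/_ a (2 ^ n) {{2^n≢0 n}}
shiftR≡/2^ a zero = sym (n/1≡n a)
shiftR≡/2^ a (suc n) =
  trans (shiftR≡/2^ (a / 2) n) (m/n/o≡m/[n*o] a 2 (2 ^ n) {{_}} {{2^n≢0 n}} {{2^n≢0 (suc n)}})

module _ (a k : ℕ) where

  leadingDigits : ℕ → ℕ
  leadingDigits i = prefixSum a k i i

  prefixSum-double : ∀ j n → n ≤ j → prefixSum a k (suc j) n ≡ prefixSum a k j n * 2
  prefixSum-double j zero _ = refl
  prefixSum-double j (suc n) n<j = begin
      prefixSum a k (suc j) n + d * 2 ^ (j ∸ n)
    ≡⟨ cong₂ (λ s e → s + d * 2 ^ e) (prefixSum-double j n (<⇒≤ n<j)) (+-∸-assoc 1 n<j) ⟩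
      prefixSum a k j n * 2 + d * (2 * 2 ^ (j ∸ suc n))
    ≡⟨ distrib (prefixSum a k j n) d (2 ^ (j ∸ suc n)) ⟩
      (prefixSum a k j n + d * 2 ^ (j ∸ suc n)) * 2
    ∎
    where
    open ≡-Reasoning
    d = digit a k (suc n)
    distrib : ∀ x y z → x * 2 + y * (2 * z) ≡ (x + y * z) * 2
    distrib = solve-∀

  leadingDigits-suc : ∀ i → leadingDigits (suc i) ≡ leadingDigits i * 2 + digit a k (suc i)
  leadingDigits-suc i rewrite prefixSum-double i i ≤-refl | n∸n≡0 i | *-identityʳ (digit a k (suc i)) = refl

  digit-binary : ∀ i → digit a k (suc i) ≡ 0 ⊎ digit a k (suc i) ≡ 1
  digit-binary i with suc i ≤ᵇ k
  ... | false = inj₁ refl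
  ... | true = binary (m%n<n (shiftR a (k ∸ suc i)) 2)
    where
    binary : ∀ {r} → r < 2 → r ≡ 0 ⊎ r ≡ 1
    binary z<s = inj₁ refl
    binary (s<s z<s) = inj₂ refl

  module _ (a<2^k : a < 2 ^ k) where

    leadingDigits≡shiftR : ∀ i → i ≤ k → leadingDigits i ≡ shiftR a (k ∸ i)
    leadingDigits≡shiftR zero _ = sym (trans (shiftR≡/2^ a k) (m<n⇒m/n≡0 {{2^n≢0 k}} a<2^k))
    leadingDigits≡shiftR (suc i) i<k = begin
        leadingDigits (suc i)                 ≡⟨ leadingDigits-suc i ⟩
        leadingDigits i * 2 + digit a k (suc i) ≡⟨ cong₂ _+_ (cong (_* 2) ih) lastDigit ⟩
        shiftR a (k ∸ i) * 2 + y % 2           ≡⟨ cong (λ e → shiftR a e * 2 + y % 2) (+-∸-assoc 1 i<k) ⟩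
        shiftR a (suc (k ∸ suc i)) * 2 + y % 2 ≡⟨ cong (λ q → q * 2 + y % 2) (shiftR-suc a (k ∸ suc i)) ⟩
        y / 2 * 2 + y % 2                      ≡⟨ +-comm (y / 2 * 2) (y % 2) ⟩
        y % 2 + y / 2 * 2                      ≡⟨ m≡m%n+[m/n]*n y 2 ⟨
        y                                      ∎
      where
      open ≡-Reasoning
      y = shiftR a (k ∸ suc i)
      ih = leadingDigits≡shiftR i (<⇒≤ i<k)
      lastDigit : digit a k (suc i) ≡ y % 2
      lastDigit rewrite dec-true (suc i ≤? k) i<k = refl

    leadingDigits-beyond : ∀ t → leadingDigits (k + t) ≡ a * 2 ^ t
    leadingDigits-beyond zero = begin
      leadingDigits (k + 0)  ≡⟨ cong leadingDigits (+-identityʳ k) ⟩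
      leadingDigits k        ≡⟨ leadingDigits≡shiftR k ≤-refl ⟩
      shiftR a (k ∸ k)       ≡⟨ cong (shiftR a) (n∸n≡0 k) ⟩
      a                      ≡⟨ *-identityʳ a ⟨
      a * 1                  ∎
      where open ≡-Reasoning
    leadingDigits-beyond (suc t) rewrite +-suc k t = begin
        leadingDigits (suc (k + t))
      ≡⟨ leadingDigits-suc (k + t) ⟩
        leadingDigits (k + t) * 2 + digit a k (suc (k + t))
      ≡⟨ cong₂ _+_ (cong (_* 2) (leadingDigits-beyond t)) pastLast ⟩
        a * 2 ^ t * 2 + 0
      ≡⟨ shift a (2 ^ t) ⟩
        a * (2 * 2 ^ t)
      ∎
      where
      open ≡-Reasoning
      pastLast : digit a k (suc (k + t)) ≡ 0
      pastLast rewrite dec-false (suc (k + t) ≤? k) (<⇒≱ (s≤s (m≤m+n k t))) = refl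
      shift : ∀ x y → x * y * 2 + 0 ≡ x * (2 * y)
      shift = solve-∀

    Bracketed : ℕ → Set
    Bracketed i = (leadingDigits i /2^ i) ≤ᵈ (a /2^ k) × (a /2^ k) <ᵈ (suc (leadingDigits i) /2^ i)

    bracketed-within : ∀ i → i ≤ k → Bracketed i
    bracketed-within i i≤k = lower , upper
      where
      open ≤-Reasoning
      M = 2 ^ (k ∸ i)
      instance _ = 2^n≢0 (k ∸ i)
      L≡a/M : leadingDigits i ≡ a / M
      L≡a/M = trans (leadingDigits≡shiftR i i≤k) (shiftR≡/2^ a (k ∸ i))
      rescale : ∀ x → x * 2 ^ k ≡ x * M * 2 ^ i
      rescale x = trans (cong (x *_) (2^-split i≤k)) (x*[y*z]≡x*z*y x _ _)
      lower : leadingDigits i * 2 ^ k ≤ a * 2 ^ i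
      lower = begin
        leadingDigits i * 2 ^ k  ≡⟨ cong (_* 2 ^ k) L≡a/M ⟩
        a / M * 2 ^ k            ≡⟨ rescale (a / M) ⟩
        a / M * M * 2 ^ i        ≤⟨ *-monoˡ-≤ (2 ^ i) (m/n*n≤m a M) ⟩
        a * 2 ^ i                ∎
      upper : a * 2 ^ i < suc (leadingDigits i) * 2 ^ k
      upper = begin-strict
        a * 2 ^ i                      <⟨ *-monoˡ-< (2 ^ i) {{2^n≢0 i}} (m<[1+m/n]*n a M) ⟩
        suc (a / M) * M * 2 ^ i        ≡⟨ rescale (suc (a / M)) ⟨
        suc (a / M) * 2 ^ k            ≡⟨ cong (λ L → suc L * 2 ^ k) L≡a/M ⟨
        suc (leadingDigits i) * 2 ^ k  ∎

    bracketed-beyond : ∀ t → Bracketed (k + t)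
    bracketed-beyond t = ≤-reflexive exact , subst (_< 2 ^ k + L * 2 ^ k) exact (m<n+m (L * 2 ^ k) (m^n>0 2 k))
      where
      L = leadingDigits (k + t)
      exact : L * 2 ^ k ≡ a * 2 ^ (k + t)
      exact = begin
        L * 2 ^ k          ≡⟨ cong (_* 2 ^ k) (leadingDigits-beyond t) ⟩
        a * 2 ^ t * 2 ^ k  ≡⟨ x*[y*z]≡x*z*y a (2 ^ k) (2 ^ t) ⟨
        a * (2 ^ k * 2 ^ t) ≡⟨ cong (a *_) (^-distribˡ-+-* 2 k t) ⟨
        a * 2 ^ (k + t)    ∎
        where open ≡-Reasoning

    leadingDigits-bracketed : ∀ i → Bracketed i
    leadingDigits-bracketed i with ≤-total i k
    ... | inj₁ i≤k = bracketed-within i i≤k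
    ... | inj₂ k≤i = subst Bracketed (m+[n∸m]≡n k≤i) (bracketed-beyond (i ∸ k))

  module _ (i : ℕ) where

    zerosUpTo-suc-digit≡0 : digit a k (suc i) ≡ 0 → zerosUpTo a k (suc i) ≡ suc (zerosUpTo a k i)
    zerosUpTo-suc-digit≡0 dᵢ₊₁≡0 rewrite dᵢ₊₁≡0 = +-comm (zerosUpTo a k i) 1

    zerosUpTo-suc-digit≡1 : digit a k (suc i) ≡ 1 → zerosUpTo a k (suc i) ≡ zerosUpTo a k i
    zerosUpTo-suc-digit≡1 dᵢ₊₁≡1 rewrite dᵢ₊₁≡1 = +-identityʳ (zerosUpTo a k i)

    leadingDigits-suc-digit≡0 : digit a k (suc i) ≡ 0 → leadingDigits (suc i) ≡ leadingDigits i * 2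
    leadingDigits-suc-digit≡0 dᵢ₊₁≡0 rewrite leadingDigits-suc i | dᵢ₊₁≡0 =
      +-identityʳ (leadingDigits i * 2)

    leadingDigits-suc-digit≡1 : digit a k (suc i) ≡ 1 → suc (leadingDigits (suc i)) ≡ suc (leadingDigits i) * 2
    leadingDigits-suc-digit≡1 dᵢ₊₁≡1 rewrite leadingDigits-suc i | dᵢ₊₁≡1 =
      cong suc (+-comm (leadingDigits i * 2) 1)

    1+leadingDigits≡truncNum : digit a k (suc i) ≡ 0 → suc (leadingDigits (suc i)) ≡ truncNum a k (suc i)
    1+leadingDigits≡truncNum dᵢ₊₁≡0 rewrite dᵢ₊₁≡0 =
      trans (cong suc (+-identityʳ (prefixSum a k (suc i) i))) (+-comm 1 (prefixSum a k (suc i) i))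

≈G-replaceOptions : ∀ {l r l′ r′} → ¬ (mk [ l′ ] [ r′ ] ≤G l) → l′ ≤G l → r ≈G r′ →
                    mk [ l ] [ r ] ≈G mk [ l′ ] [ r′ ]
≈G-replaceOptions B≰l l′≤l (r≤r′ , r′≤r) =
    ((B≰l , tt) , (rightOption-≤⇒≱G r≤r′ , tt))
  , ((≤-leftOption⇒≱G l′≤l , tt) , (rightOption-≤⇒≱G r′≤r , tt))

ordSumNeg : Game → ℕ → Game
ordSumNeg G n = ordSum G (intGame (ℤ.- (+ n)))

ordSumNeg-suc : ∀ l n → ordSumNeg (mk [ l ] []) (suc n) ≡ mk [ l ] [ ordSumNeg (mk [ l ] []) n ]
ordSumNeg-suc l zero = refl
ordSumNeg-suc l (suc n) = refl

module _ (a k : ℕ) (a<2^k : a < 2 ^ k) where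
  private
    G = baseGame a k
    d-form = dyadic-form a k

  d<ᵈ1+n : ∀ n → (a /2^ k) <ᵈ (suc n /2^ 0)
  d<ᵈ1+n n = begin-strict
    a * 1        ≡⟨ *-identityʳ a ⟩
    a            <⟨ a<2^k ⟩
    2 ^ k        ≤⟨ m≤n*m (2 ^ k) (suc n) ⟩
    suc n * 2 ^ k ∎
    where open ≤-Reasoning

  baseGame≈1 : G ≈G natGame 1
  baseGame≈1 = ((<ᵈ⇒≱G d-form (natGame-form 1) (d<ᵈ1+n 0) , tt) , tt)
             , (((λ ((0≰d , _) , _) → 0≰d (≤ᵈ⇒≤G zero-form d-form z≤n)) , tt) , tt)

  ordSum-natGame : ∀ n → ordSum G (natGame n) ≈G natGame (suc n)
  ordSum-natGame zero = baseGame≈1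
  ordSum-natGame (suc n) =
      ((<ᵈ⇒≱G d-form (natGame-form (2 + n)) (d<ᵈ1+n (suc n)) , ≤-leftOption⇒≱G (proj₁ ih) , tt) , tt)
    , (((λ ((_ , n+1≰G:n , _) , _) → n+1≰G:n (proj₂ ih)) , tt) , tt)
    where ih = ordSum-natGame n

  ordSumNeg-zerosUpTo : ∀ i → ordSumNeg G (zerosUpTo a k i) ≈G dyadic (+ suc (leadingDigits a k i)) i
  ordSumNeg-zerosUpTo zero = baseGame≈1
  ordSumNeg-zerosUpTo (suc i) with digit-binary a k i
  ... | inj₁ dᵢ₊₁≡0 = subst₂ _≈G_ lhs rhs (≈G-replaceOptions d≱B p≤d (ordSumNeg-zerosUpTo i))
    where
    L = leadingDigits a k i
    L′≡2L = leadingDigits-suc-digit≡0 a k i dᵢ₊₁≡0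
    lhs : mk [ dyadic (+ a) k ] [ ordSumNeg G (zerosUpTo a k i) ] ≡ ordSumNeg G (zerosUpTo a k (suc i))
    lhs = trans (sym (ordSumNeg-suc _ _)) (cong (ordSumNeg G) (sym (zerosUpTo-suc-digit≡0 a k i dᵢ₊₁≡0)))
    rhs : mk [ dyadic (+ L) i ] [ dyadic (+ suc L) i ] ≡ dyadic (+ suc (leadingDigits a k (suc i))) (suc i)
    rhs = trans (sym (dyadic-odd L i)) (cong (λ x → dyadic (+ suc x) (suc i)) (sym L′≡2L))
    d≱B : ¬ (mk [ dyadic (+ L) i ] [ dyadic (+ suc L) i ] ≤G dyadic (+ a) k)
    d≱B = <ᵈ⇒≱G d-form (odd-form (dyadic-form L i) (dyadic-form (suc L) i))
            (subst (λ x → (a /2^ k) <ᵈ (suc x /2^ suc i)) L′≡2L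
              (proj₂ (leadingDigits-bracketed a k a<2^k (suc i))))
    p≤d : dyadic (+ L) i ≤G dyadic (+ a) k
    p≤d = ≤ᵈ⇒≤G (dyadic-form L i) d-form (proj₁ (leadingDigits-bracketed a k a<2^k i))
  ... | inj₂ dᵢ₊₁≡1 =
    subst₂ _≈G_ (cong (ordSumNeg G) (sym (zerosUpTo-suc-digit≡1 a k i dᵢ₊₁≡1)))
                (trans (sym (dyadic-even (suc L) i))
                       (cong (λ x → dyadic (+ x) (suc i)) (sym (leadingDigits-suc-digit≡1 a k i dᵢ₊₁≡1))))
                (ordSumNeg-zerosUpTo i)
    where L = leadingDigits a k i

theorem2p10 : (k a : ℕ) → a < 2 ^ k → (m : ℤ) →
    ((ℤ.0ℤ ℤ.≤ m → ordSum (baseGame a k) (intGame m) ≈G intGame (m ℤ.+ ℤ.1ℤ))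
    × (m ℤ.< ℤ.0ℤ → (j : ℕ) → digit a k j ≡ 0 → zerosUpTo a k j ≡ ∣ m ∣ →
         ordSum (baseGame a k) (intGame m) ≈G dyadic (+ truncNum a k j) j))
theorem2p10 k a a<2^k (+ n) =
  (λ _ → subst (λ m → ordSum (baseGame a k) (natGame n) ≈G natGame m) (+-comm 1 n)
                (ordSum-natGame a k a<2^k n)) ,
  λ { (ℤ.+<+ ()) }
theorem2p10 k a a<2^k -[1+ n ] = (λ ()) , λ where
  _ zero _ ()
  _ (suc i) dⱼ≡0 zerosⱼ≡1+n →
    subst₂ _≈G_ (cong (ordSumNeg (baseGame a k)) zerosⱼ≡1+n)
                (cong (λ x → dyadic (+ x) (suc i)) (1+leadingDigits≡truncNum a k i dⱼ≡0))
                (ordSumNeg-zerosUpTo a k a<2^k (suc i))
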